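{- Let $m\ge 2$ and $n\ge1$. Any permutation $\pi\in\mathcal{S}_n$ is uniquely determined by the set of its diagram squares of rank at most $m-3$ together with the set of pairs $(i,j)$, $1\le i<j\le n$, such that $i,j$ are the final two terms of an occurrence in $\pi$ of a pattern belonging to $B_m$. That is, if $\pi,\pi'\in\mathcal{S}_n$ have the same diagram squares of rank at most $m-3$ and the same set of such pairs, then $\pi=\pi'$.
   Context: For $\tau\in\mathcal{S}_m$, an occurrence of $\tau$ in $\pi\in\mathcal{S}_n$ is a sequence $1\le i_1<\dots<i_m\le n$ such that $\pi_{i_1}\cdots\pi_{i_m}$ is order-isomorphic to $\tau$. Let $B_m=\{\tau\in\mathcal{S}_m:\tau_{m-1}=m-1,\ \tau_m=m\}$. The diagram of $\pi$: in an $n\times n$ array with rows numbered top to bottom and columns left to right, place a dot in cell $(i,\pi_i)$ for each $i$, and shade each dotted cell together with all cells due south (same column, larger row) and due east (same row, larger column) of it. The unshaded cells are the diagram squares; equivalently, $(i,j)$ is a diagram square iff $j<\pi_i$ and $\pi^{ -1}(j)>i$. The rank of a diagram square $(i,j)$ is $|\{k<i:\pi_k<j\}|$, the number of dots strictly northwest of it. -}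

module Defs where

open import Data.Nat using (ℕ; _+_; _≤_)
open import Data.Bool using (_∧_)
open import Data.Fin using (Fin; toℕ; _<_; _<?_)
open import Data.Fin.Permutation using (Permutation′; _⟨$⟩ʳ_; _⟨$⟩ˡ_)
open import Data.List using (length; filterᵇ; allFin)
open import Data.Product using (Σ; _×_)
open import Relation.Nullary.Decidable using (⌊_⌋)
open import Relation.Binary.PropositionalEquality using (_≡_)

-- Indices are 0-based: position i ∈ Fin n, value π i ∈ Fin n.

DiagramSquare : ∀ {n} → Permutation′ n → Fin n → Fin n → Set
DiagramSquare π i j = (j < π ⟨$⟩ʳ i) × (i < π ⟨$⟩ˡ j)

rank : ∀ {n} → Permutation′ n → Fin n → Fin n → ℕ
rank {n} π i j =
  length (filterᵇ (λ k → ⌊ k <? i ⌋ ∧ ⌊ π ⟨$⟩ʳ k <? j ⌋) (allFin n))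

-- diagram square of rank at most m - 3 (as integers; for m = 2 there are none)
LowRankSquare : ∀ {n} → ℕ → Permutation′ n → Fin n → Fin n → Set
LowRankSquare m π i j = DiagramSquare π i j × (rank π i j + 3 ≤ m)

-- B_m: τ ∈ S_m fixing its last two positions, i.e. τ_{m-1} = m-1, τ_m = m.
InB : ∀ {m} → Permutation′ m → Set
InB {m} τ = ∀ (a : Fin m) → m ≤ toℕ a + 2 → toℕ (τ ⟨$⟩ʳ a) ≡ toℕ a

StrictlyIncreasing : ∀ {m n} → (Fin m → Fin n) → Set
StrictlyIncreasing {m} f = ∀ (a b : Fin m) → a < b → f a < f b

Occurrence : ∀ {m n} → Permutation′ m → Permutation′ n → (Fin m → Fin n) → Set
Occurrence {m} τ π f =
  StrictlyIncreasing f ×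
  (∀ (a b : Fin m) → (π ⟨$⟩ʳ f a < π ⟨$⟩ʳ f b → τ ⟨$⟩ʳ a < τ ⟨$⟩ʳ b)
                   × (τ ⟨$⟩ʳ a < τ ⟨$⟩ʳ b → π ⟨$⟩ʳ f a < π ⟨$⟩ʳ f b))

BPair : ∀ {n} → ℕ → Permutation′ n → Fin n → Fin n → Set
BPair {n} m π i j =
  (i < j) ×
  Σ (Permutation′ m) λ τ → InB τ ×
  Σ (Fin m → Fin n) λ f → Occurrence τ π f ×
  (∀ (a : Fin m) → toℕ a + 2 ≡ m → f a ≡ i) ×
  (∀ (a : Fin m) → toℕ a + 1 ≡ m → f a ≡ j)

-- Induct on the value v: assume that the values below v sit at the same positions in π and π′,
-- and that v sits earlier in π, at P, than in π′, at P′ (the other case is symmetric).  The dots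
-- northwest of the cell (P , v) are then the same for both permutations, so the cell has the same
-- rank r for both; it is a diagram square of π′ but not of π, which has its dot there.  As the
-- low-rank squares agree, r ≥ m - 2.  Then m - 2 of those dots, followed by P and P′, form an
-- occurrence in π of a pattern of B_m ending at (P , P′); but π′ has no such occurrence, since
-- π′(P) > v = π′(P′).
{-# OPTIONS --safe #-}
module Submission where

open import Defs
open import Data.Nat using (ℕ; _≤_)
open import Data.Fin using (Fin)
open import Data.Fin.Permutation using (Permutation′; _⟨$⟩ʳ_)
open import Function.Bundles using (_⇔_)
open import Relation.Binary.PropositionalEquality using (_≡_)

open import Data.Nat as ℕ using (zero; suc; _+_; z≤n; s≤s; s≤s⁻¹)
import Data.Nat.Properties as ℕ
open import Data.Fin using (zero; suc; toℕ; fromℕ; fromℕ<; inject₁; punchOut; _<_; _<?_)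
open import Data.Fin.Properties
  using (<-cmp; <-irrefl; <-asym; <-trans; <⇒≢; toℕ-fromℕ; toℕ-fromℕ<; toℕ-inject₁; toℕ<n;
         any?; _≟_; punchOut-injective; injective⇒≤)
open import Data.Fin.Permutation using (_⟨$⟩ˡ_; inverseˡ; inverseʳ; permutation)
open import Data.Fin.Induction using (<-wellFounded)
open import Data.Vec.Functional using (_∷_)
open import Data.List using (length; filter; tabulate)
open import Data.Bool using (true; false; if_then_else_; _∧_)
open import Data.Product using (Σ; ∃; _×_; _,_; proj₁; proj₂; map₂)
open import Data.Sum using (_⊎_; inj₁; inj₂)
open import Data.Empty using (⊥; ⊥-elim)
open import Data.Unit using (⊤; tt)
open import Level using (0ℓ)
open import Function using (_∘_; _∘₂_; _∋_)
open import Function.Bundles using (Equivalence; Injection; mk⇔)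
open import Function.Definitions using (Injective)
import Function.Properties.Equivalence as ⇔
open import Function.Properties.Inverse using (Inverse⇒Injection)
import Induction.WellFounded as WF
open import Relation.Binary using (tri<; tri≈; tri>)
open import Relation.Binary.PropositionalEquality
  using (_≢_; refl; sym; trans; cong; cong₂; subst; subst₂; module ≡-Reasoning)
open import Relation.Nullary using (¬_; Dec; yes; no; does; contradiction)
open import Relation.Nullary.Decidable using (_×-dec_; isYes≗does)
open import Relation.Unary using (Pred; Decidable; _⊆_)

-- Counting

count : ∀ {n p} {P : Pred (Fin n) p} → Decidable P → ℕ
count {zero}  P? = 0
count {suc n} P? = (if does (P? zero) then 1 else 0) + count (P? ∘ suc)

length-filter-tabulate : ∀ {a p q n} {A : Set a} {P : Pred A p} {Q : Pred (Fin n) q}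
  (P? : Decidable P) (Q? : Decidable Q) (f : Fin n → A) →
  (∀ x → does (P? (f x)) ≡ does (Q? x)) → length (filter P? (tabulate f)) ≡ count Q?
length-filter-tabulate {n = zero}  P? Q? f same = refl
length-filter-tabulate {n = suc n} P? Q? f same
  with does (P? (f zero)) | does (Q? zero) | same zero
     | length-filter-tabulate P? (Q? ∘ suc) (f ∘ suc) (same ∘ suc)
... | true  | true  | refl | ih = cong suc ih
... | false | false | refl | ih = ih

count-mono : ∀ {n p q} {P : Pred (Fin n) p} {Q : Pred (Fin n) q}
  (P? : Decidable P) (Q? : Decidable Q) → P ⊆ Q → count P? ℕ.≤ count Q?
count-mono {zero}  P? Q? P⊆Q = z≤n
count-mono {suc n} P? Q? P⊆Q
  with P? zero | Q? zero | count-mono (P? ∘ suc) (Q? ∘ suc) P⊆Q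
... | yes _  | yes _  | ih = s≤s ih
... | yes p₀ | no ¬q₀ | _  = contradiction (P⊆Q p₀) ¬q₀
... | no _   | yes _  | ih = ℕ.m≤n⇒m≤1+n ih
... | no _   | no _   | ih = ih

count-strict : ∀ {n p q} {P : Pred (Fin n) p} {Q : Pred (Fin n) q}
  (P? : Decidable P) (Q? : Decidable Q) → P ⊆ Q →
  ∀ {a} → Q a → ¬ P a → count P? ℕ.< count Q?
count-strict {suc n} P? Q? P⊆Q {zero} qa ¬pa with P? zero | Q? zero
... | yes pa | _      = contradiction pa ¬pa
... | no _   | yes _  = s≤s (count-mono (P? ∘ suc) (Q? ∘ suc) P⊆Q)
... | no _   | no ¬qa = contradiction qa ¬qa
count-strict {suc n} P? Q? P⊆Q {suc a} qa ¬pa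
  with P? zero | Q? zero | count-strict (P? ∘ suc) (Q? ∘ suc) P⊆Q qa ¬pa
... | yes _  | yes _  | ih = s≤s ih
... | yes p₀ | no ¬q₀ | _  = contradiction (P⊆Q p₀) ¬q₀
... | no _   | yes _  | ih = ℕ.m<n⇒m<1+n ih
... | no _   | no _   | ih = ih

count-cong : ∀ {n p q} {P : Pred (Fin n) p} {Q : Pred (Fin n) q}
  (P? : Decidable P) (Q? : Decidable Q) → (∀ x → P x ⇔ Q x) → count P? ≡ count Q?
count-cong P? Q? P⇔Q = ℕ.≤-antisym
  (count-mono P? Q? (Equivalence.to (P⇔Q _)))
  (count-mono Q? P? (Equivalence.from (P⇔Q _)))

count-universal : ∀ {n p} {P : Pred (Fin n) p} (P? : Decidable P) → (∀ x → P x) →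
                  count P? ≡ n
count-universal {zero}  P? all = refl
count-universal {suc n} P? all with P? zero
... | yes _  = cong suc (count-universal (P? ∘ suc) (all ∘ suc))
... | no ¬p₀ = contradiction (all zero) ¬p₀

count-none : ∀ {n p} {P : Pred (Fin n) p} (P? : Decidable P) → (∀ x → ¬ P x) → count P? ≡ 0
count-none {zero}  P? none = refl
count-none {suc n} P? none with P? zero
... | yes p₀ = contradiction p₀ (none zero)
... | no _   = count-none (P? ∘ suc) (none ∘ suc)

count<n : ∀ {n p} {P : Pred (Fin n) p} (P? : Decidable P) {a} → ¬ P a → count P? ℕ.< n
count<n {n} P? ¬pa =
  subst (count P? ℕ.<_) (count-universal ⊤? _) (count-strict P? ⊤? _ tt ¬pa)
  where
  ⊤? : Decidable {A = Fin n} (λ _ → ⊤)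
  ⊤? _ = yes tt

count-< : ∀ {n} (a : Fin n) → count (λ (c : Fin n) → c <? a) ≡ toℕ a
count-< {suc n} zero = count-none (λ (c : Fin n) → suc c <? (Fin (suc n) ∋ zero)) (λ c ())
count-< {suc n} (suc a) with (Fin (suc n) ∋ zero) <? suc a
... | yes _ = cong suc (begin
  count (λ (c : Fin n) → suc c <? suc a)
    ≡⟨ count-cong (λ (c : Fin n) → suc c <? suc a) (_<? a) (λ c → mk⇔ s≤s⁻¹ s≤s) ⟩
  count (λ (c : Fin n) → c <? a)
    ≡⟨ count-< a ⟩
  toℕ a ∎)
  where open ≡-Reasoning
... | no ¬0<1+a = contradiction (s≤s z≤n) ¬0<1+a

count-extract : ∀ {n p} {P : Pred (Fin n) p} (P? : Decidable P) {k} → k ℕ.≤ count P? →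
  Σ (Fin k → Fin n) λ g → StrictlyIncreasing g × (∀ c → P (g c))
count-extract P? {zero} _ = (λ ()) , (λ ()) , (λ ())
count-extract {suc n} P? {suc k} k≤count with P? zero
... | yes p₀ with count-extract (P? ∘ suc) (s≤s⁻¹ k≤count)
...   | g , g-inc , g-P = zero ∷ suc ∘ g , cons-inc , (λ { zero → p₀ ; (suc c) → g-P c })
  where
  cons-inc : StrictlyIncreasing (zero ∷ suc ∘ g)
  cons-inc zero    (suc b) _   = s≤s z≤n
  cons-inc (suc a) (suc b) a<b = s≤s (g-inc a b (s≤s⁻¹ a<b))
count-extract {suc n} P? {suc k} k≤count | no _ with count-extract (P? ∘ suc) k≤count
...   | g , g-inc , g-P = suc ∘ g , (λ a b a<b → s≤s (g-inc a b a<b)) , g-P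

-- Standardization of a sequence

injective⇒surjective : ∀ {n} {f : Fin n → Fin n} → Injective _≡_ _≡_ f →
                       ∀ y → ∃ λ x → f x ≡ y
injective⇒surjective {suc n} {f} f-injective y with any? (λ x → f x ≟ y)
... | yes hit = hit
... | no ¬hit = contradiction (injective⇒≤ punchOut∘f-injective) ℕ.1+n≰n
  where
  y≢f : ∀ x → y ≢ f x
  y≢f x y≡fx = ¬hit (x , sym y≡fx)

  punchOut∘f-injective : Injective _≡_ _≡_ (λ x → punchOut (y≢f x))
  punchOut∘f-injective eq = f-injective (punchOut-injective (y≢f _) (y≢f _) eq)

strictlyIncreasing⇒injective : ∀ {m n} {f : Fin m → Fin n} →
                               StrictlyIncreasing f → Injective _≡_ _≡_ f
strictlyIncreasing⇒injective f-inc {a} {b} fa≡fb with <-cmp a b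
... | tri< a<b _ _ = contradiction (f-inc a b a<b) (<-irrefl fa≡fb)
... | tri≈ _ a≡b _ = a≡b
... | tri> _ _ b<a = contradiction (f-inc b a b<a) (<-irrefl (sym fa≡fb))

permutation-injective : ∀ {n} (π : Permutation′ n) → Injective _≡_ _≡_ (π ⟨$⟩ʳ_)
permutation-injective π = Injection.injective (Inverse⇒Injection π)

module Standardization {m n} (h : Fin m → Fin n) (h-injective : Injective _≡_ _≡_ h) where

  std : Fin m → Fin m
  std a = fromℕ< (count<n (λ c → h c <? h a) (<-irrefl refl))

  toℕ-std : ∀ a → toℕ (std a) ≡ count (λ c → h c <? h a)
  toℕ-std a = toℕ-fromℕ< _

  std-mono : ∀ {a b} → h a < h b → std a < std b
  std-mono {a} {b} ha<hb = subst₂ ℕ._<_ (sym (toℕ-std a)) (sym (toℕ-std b))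
    (count-strict (λ c → h c <? h a) (λ c → h c <? h b) (λ hc<ha → <-trans hc<ha ha<hb)
                  ha<hb (<-irrefl refl))

  std-injective : Injective _≡_ _≡_ std
  std-injective {a} {b} std-a≡std-b with <-cmp (h a) (h b)
  ... | tri< ha<hb _ _ = contradiction (std-mono ha<hb) (<-irrefl std-a≡std-b)
  ... | tri≈ _ ha≡hb _ = h-injective ha≡hb
  ... | tri> _ _ hb<ha = contradiction (std-mono hb<ha) (<-irrefl (sym std-a≡std-b))

  std-reflects : ∀ {a b} → std a < std b → h a < h b
  std-reflects {a} {b} std-a<std-b with <-cmp (h a) (h b)
  ... | tri< ha<hb _ _ = ha<hb
  ... | tri≈ _ ha≡hb _ = contradiction std-a<std-b (<-irrefl (cong std (h-injective ha≡hb)))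
  ... | tri> _ _ hb<ha = contradiction std-a<std-b (<-asym (std-mono hb<ha))

  standardize : Permutation′ m
  standardize = permutation std (proj₁ ∘ surjective) (proj₂ ∘ surjective)
                  (λ x → std-injective (proj₂ (surjective (std x))))
    where surjective = injective⇒surjective std-injective

  standardize-fixes : ∀ {a} → (∀ c → c < a → h c < h a) → (∀ c → a < c → h a < h c) →
                      toℕ (standardize ⟨$⟩ʳ a) ≡ toℕ a
  standardize-fixes {a} left right = begin
    toℕ (std a)                     ≡⟨ toℕ-std a ⟩
    count (λ c → h c <? h a)        ≡⟨ count-cong (λ c → h c <? h a) (_<? a)
                                                  (λ c → mk⇔ (to c) (left c)) ⟩
    count (λ (c : Fin m) → c <? a)  ≡⟨ count-< a ⟩
    toℕ a                           ∎
    where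
    open ≡-Reasoning
    to : ∀ c → h c < h a → c < a
    to c hc<ha with <-cmp c a
    ... | tri< c<a _ _ = c<a
    ... | tri≈ _ c≡a _ = contradiction hc<ha (<-irrefl (cong h c≡a))
    ... | tri> _ _ a<c = contradiction hc<ha (<-asym (right c a<c))

standardize-occurrence : ∀ {m n} (π : Permutation′ n) {f : Fin m → Fin n}
  (f-inc : StrictlyIncreasing f) →
  Occurrence (Standardization.standardize (λ a → π ⟨$⟩ʳ f a)
               (strictlyIncreasing⇒injective f-inc ∘ permutation-injective π)) π f
standardize-occurrence π f-inc = f-inc , λ a b → std-mono , std-reflects
  where open Standardization _ (strictlyIncreasing⇒injective f-inc ∘ permutation-injective π)

-- Occurrences of patterns in B_m

infixl 5 _∷ʳ_

_∷ʳ_ : ∀ {k} {A : Set} → (Fin k → A) → A → Fin (suc k) → A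
_∷ʳ_ {zero}  u x zero    = x
_∷ʳ_ {suc k} u x zero    = u zero
_∷ʳ_ {suc k} u x (suc a) = (u ∘ suc ∷ʳ x) a

∷ʳ-last : ∀ {k} {A : Set} (u : Fin k → A) x (a : Fin (suc k)) → toℕ a ≡ k → (u ∷ʳ x) a ≡ x
∷ʳ-last {zero}  u x zero    _   = refl
∷ʳ-last {suc k} u x (suc a) a≡k = ∷ʳ-last (u ∘ suc) x a (ℕ.suc-injective a≡k)

∷ʳ-init : ∀ {k} {A : Set} (u : Fin k → A) x (a : Fin (suc k)) (c : Fin k) →
          toℕ a ≡ toℕ c → (u ∷ʳ x) a ≡ u c
∷ʳ-init {suc k} u x zero    zero    _   = refl
∷ʳ-init {suc k} u x (suc a) (suc c) a≡c = ∷ʳ-init (u ∘ suc) x a c (ℕ.suc-injective a≡c)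

∷ʳ-all : ∀ {k} {A : Set} (Q : A → Set) {u : Fin k → A} {x} →
         (∀ c → Q (u c)) → Q x → ∀ a → Q ((u ∷ʳ x) a)
∷ʳ-all {zero}  Q Qu Qx zero    = Qx
∷ʳ-all {suc k} Q Qu Qx zero    = Qu zero
∷ʳ-all {suc k} Q Qu Qx (suc a) = ∷ʳ-all Q (Qu ∘ suc) Qx a

∷ʳ-increasing : ∀ {k n} {u : Fin k → Fin n} {x} →
                StrictlyIncreasing u → (∀ c → u c < x) → StrictlyIncreasing (u ∷ʳ x)
∷ʳ-increasing {suc k} u-inc u<x zero    (suc b) _   =
  ∷ʳ-all (_ <_) (λ c → u-inc zero (suc c) (s≤s z≤n)) (u<x zero) b
∷ʳ-increasing {suc k} u-inc u<x (suc a) (suc b) a<b =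
  ∷ʳ-increasing (λ c d c<d → u-inc (suc c) (suc d) (s≤s c<d)) (u<x ∘ suc) a b (s≤s⁻¹ a<b)

NorthwestOf : ∀ {n} → Permutation′ n → Fin n → Fin n → Pred (Fin n) 0ℓ
NorthwestOf π i j x = x < i × π ⟨$⟩ʳ x < j

northwestOf? : ∀ {n} (π : Permutation′ n) i j → Decidable (NorthwestOf π i j)
northwestOf? π i j x = x <? i ×-dec π ⟨$⟩ʳ x <? j

rank-count : ∀ {n} (π : Permutation′ n) i j → rank π i j ≡ count (northwestOf? π i j)
rank-count π i j = length-filter-tabulate _ (northwestOf? π i j) (λ x → x)
  (λ x → cong₂ _∧_ (isYes≗does (x <? i)) (isYes≗does (π ⟨$⟩ʳ x <? j)))

NorthwestOrEnd : ∀ {n} → Permutation′ n → Fin n → Fin n → Pred (Fin n) 0ℓ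
NorthwestOrEnd π i j x = NorthwestOf π i (π ⟨$⟩ʳ i) x ⊎ x ≡ i ⊎ x ≡ j

NorthwestOrEnd-monotone : ∀ {n} (π : Permutation′ n) {i j} → i < j → π ⟨$⟩ʳ i < π ⟨$⟩ʳ j →
  ∀ {y} → y ≡ i ⊎ y ≡ j → ∀ {x} → NorthwestOrEnd π i j x →
  (x < y → π ⟨$⟩ʳ x < π ⟨$⟩ʳ y) × (y < x → π ⟨$⟩ʳ y < π ⟨$⟩ʳ x)
NorthwestOrEnd-monotone π i<j πi<πj (inj₁ refl) (inj₁ (x<i , πx<πi)) =
  (λ _ → πx<πi) , (⊥-elim ∘ <-asym x<i)
NorthwestOrEnd-monotone π i<j πi<πj (inj₁ refl) (inj₂ (inj₁ refl)) =
  (⊥-elim ∘ <-irrefl refl) , (⊥-elim ∘ <-irrefl refl)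
NorthwestOrEnd-monotone π i<j πi<πj (inj₁ refl) (inj₂ (inj₂ refl)) =
  (⊥-elim ∘ <-asym i<j) , (λ _ → πi<πj)
NorthwestOrEnd-monotone π i<j πi<πj (inj₂ refl) (inj₁ (x<i , πx<πi)) =
  (λ _ → <-trans πx<πi πi<πj) , (⊥-elim ∘ <-asym (<-trans x<i i<j))
NorthwestOrEnd-monotone π i<j πi<πj (inj₂ refl) (inj₂ (inj₁ refl)) =
  (λ _ → πi<πj) , (⊥-elim ∘ <-asym i<j)
NorthwestOrEnd-monotone π i<j πi<πj (inj₂ refl) (inj₂ (inj₂ refl)) =
  (⊥-elim ∘ <-irrefl refl) , (⊥-elim ∘ <-irrefl refl)

between-top-two : ∀ {k x} → k ℕ.≤ x → x ℕ.≤ suc k → x ≡ k ⊎ x ≡ suc k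
between-top-two k≤x x≤1+k with ℕ.m≤n⇒m<n∨m≡n x≤1+k
... | inj₁ x<1+k = inj₁ (ℕ.≤-antisym (s≤s⁻¹ x<1+k) k≤x)
... | inj₂ x≡1+k = inj₂ x≡1+k

BPair-fromEmbedding : ∀ {k n} (π : Permutation′ n) {i j} {f : Fin (2 + k) → Fin n} →
  i < j → π ⟨$⟩ʳ i < π ⟨$⟩ʳ j → StrictlyIncreasing f →
  (∀ a → toℕ a ≡ k → f a ≡ i) → (∀ a → toℕ a ≡ suc k → f a ≡ j) →
  (∀ a → NorthwestOrEnd π i j (f a)) → BPair (2 + k) π i j
BPair-fromEmbedding {k} π {i} {j} {f} i<j πi<πj f-inc f-at-k f-at-1+k f-support =
  i<j , standardize , fixes-top-two , f , standardize-occurrence π f-inc ,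
  (λ a a+2≡2+k → f-at-k a (ℕ.+-cancelˡ-≡ 2 _ _ (trans (ℕ.+-comm 2 (toℕ a)) a+2≡2+k))) ,
  (λ a a+1≡2+k → f-at-1+k a (ℕ.+-cancelˡ-≡ 1 _ _ (trans (ℕ.+-comm 1 (toℕ a)) a+1≡2+k)))
  where
  open Standardization (λ a → π ⟨$⟩ʳ f a)
                       (strictlyIncreasing⇒injective f-inc ∘ permutation-injective π)

  fixes : ∀ {a} → f a ≡ i ⊎ f a ≡ j → toℕ (standardize ⟨$⟩ʳ a) ≡ toℕ a
  fixes {a} fa∈ij = standardize-fixes
    (λ c c<a → proj₁ (monotone (f-support c)) (f-inc c a c<a))
    (λ c a<c → proj₂ (monotone (f-support c)) (f-inc a c a<c))
    where monotone = NorthwestOrEnd-monotone π i<j πi<πj fa∈ij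

  fixes-top-two : InB standardize
  fixes-top-two a 2+k≤a+2
    with between-top-two (s≤s⁻¹ (s≤s⁻¹ (subst (2 + k ℕ.≤_) (ℕ.+-comm (toℕ a) 2) 2+k≤a+2)))
                         (s≤s⁻¹ (toℕ<n a))
  ... | inj₁ a≡k   = fixes (inj₁ (f-at-k a a≡k))
  ... | inj₂ a≡1+k = fixes (inj₂ (f-at-1+k a a≡1+k))

BPair-intro : ∀ {k n} (π : Permutation′ n) {i j} → i < j → π ⟨$⟩ʳ i < π ⟨$⟩ʳ j →
              k ℕ.≤ rank π i (π ⟨$⟩ʳ i) → BPair (2 + k) π i j
BPair-intro {k} {n} π {i} {j} i<j πi<πj k≤rank =
  BPair-fromEmbedding π i<j πi<πj f-inc f-at-k (∷ʳ-last (g ∷ʳ i) j) f-support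
  where
  extracted : Σ (Fin k → Fin n) λ g →
                StrictlyIncreasing g × (∀ c → NorthwestOf π i (π ⟨$⟩ʳ i) (g c))
  extracted = count-extract (northwestOf? π i _) (subst (k ℕ.≤_) (rank-count π i _) k≤rank)

  g : Fin k → Fin n
  g = proj₁ extracted

  g-northwest : ∀ c → NorthwestOf π i (π ⟨$⟩ʳ i) (g c)
  g-northwest = proj₂ (proj₂ extracted)

  f : Fin (2 + k) → Fin n
  f = g ∷ʳ i ∷ʳ j

  f-inc : StrictlyIncreasing f
  f-inc = ∷ʳ-increasing (∷ʳ-increasing (proj₁ (proj₂ extracted)) (proj₁ ∘ g-northwest))
                        (∷ʳ-all (_< j) (λ c → <-trans (proj₁ (g-northwest c)) i<j) i<j)

  f-at-k : ∀ a → toℕ a ≡ k → f a ≡ i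
  f-at-k a a≡k = begin
    f a                 ≡⟨ ∷ʳ-init (g ∷ʳ i) j a (fromℕ k) (trans a≡k (sym (toℕ-fromℕ k))) ⟩
    (g ∷ʳ i) (fromℕ k)  ≡⟨ ∷ʳ-last g i (fromℕ k) (toℕ-fromℕ k) ⟩
    i                   ∎
    where open ≡-Reasoning

  f-support : ∀ a → NorthwestOrEnd π i j (f a)
  f-support = ∷ʳ-all (NorthwestOrEnd π i j)
    (∷ʳ-all (NorthwestOrEnd π i j) (inj₁ ∘ g-northwest) (inj₂ (inj₁ refl))) (inj₂ (inj₂ refl))

BPair⇒< : ∀ {k n} (π : Permutation′ n) {i j} → BPair (2 + k) π i j → π ⟨$⟩ʳ i < π ⟨$⟩ʳ j
BPair⇒< {k} π (_ , τ , τ∈B , f , (_ , order) , f-penult , f-last) =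
  subst₂ (λ x y → π ⟨$⟩ʳ x < π ⟨$⟩ʳ y) (f-penult penult penult+2≡2+k) (f-last last last+1≡2+k)
    (proj₂ (order penult last) τpenult<τlast)
  where
  penult last : Fin (2 + k)
  penult = inject₁ (fromℕ k)
  last   = fromℕ (suc k)

  toℕ-penult : toℕ penult ≡ k
  toℕ-penult = trans (toℕ-inject₁ (fromℕ k)) (toℕ-fromℕ k)

  penult+2≡2+k : toℕ penult + 2 ≡ 2 + k
  penult+2≡2+k = trans (cong (_+ 2) toℕ-penult) (ℕ.+-comm k 2)

  last+1≡2+k : toℕ last + 1 ≡ 2 + k
  last+1≡2+k = trans (cong (_+ 1) (toℕ-fromℕ (suc k))) (ℕ.+-comm (suc k) 1)

  2+k≤last+2 : 2 + k ℕ.≤ toℕ last + 2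
  2+k≤last+2 = ℕ.≤-trans (ℕ.≤-reflexive (sym last+1≡2+k)) (ℕ.+-monoʳ-≤ (toℕ last) (s≤s z≤n))

  τpenult<τlast : τ ⟨$⟩ʳ penult < τ ⟨$⟩ʳ last
  τpenult<τlast = subst₂ ℕ._<_
    (sym (trans (τ∈B penult (ℕ.≤-reflexive (sym penult+2≡2+k))) toℕ-penult))
    (sym (trans (τ∈B last 2+k≤last+2) (toℕ-fromℕ (suc k))))
    (ℕ.n<1+n k)

-- Permutations agreeing below a value

dot-not-DiagramSquare : ∀ {n} (π : Permutation′ n) j → ¬ DiagramSquare π (π ⟨$⟩ˡ j) j
dot-not-DiagramSquare π j (j<πP , _) = <-irrefl (sym (inverseʳ π)) j<πP

AgreeBelow : ∀ {n} → Fin n → Permutation′ n → Permutation′ n → Set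
AgreeBelow v π π′ = ∀ {u} → u < v → π ⟨$⟩ˡ u ≡ π′ ⟨$⟩ˡ u

module _ {n} {v : Fin n} (π π′ : Permutation′ n) (agree : AgreeBelow v π π′) where

  agreeBelow-sym : AgreeBelow v π′ π
  agreeBelow-sym u<v = sym (agree u<v)

  agreeBelow-value : ∀ {x} → π ⟨$⟩ʳ x < v → π′ ⟨$⟩ʳ x ≡ π ⟨$⟩ʳ x
  agreeBelow-value {x} πx<v = begin
    π′ ⟨$⟩ʳ x                       ≡⟨ cong (π′ ⟨$⟩ʳ_) (inverseˡ π) ⟨
    π′ ⟨$⟩ʳ (π ⟨$⟩ˡ (π ⟨$⟩ʳ x))   ≡⟨ cong (π′ ⟨$⟩ʳ_) (agree πx<v) ⟩
    π′ ⟨$⟩ʳ (π′ ⟨$⟩ˡ (π ⟨$⟩ʳ x))  ≡⟨ inverseʳ π′ ⟩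
    π ⟨$⟩ʳ x                        ∎
    where open ≡-Reasoning

  agreeBelow-below : ∀ {x} → π ⟨$⟩ʳ x < v → π′ ⟨$⟩ʳ x < v
  agreeBelow-below πx<v = subst (_< v) (sym (agreeBelow-value πx<v)) πx<v

agreeBelow-rank : ∀ {n v} (π π′ : Permutation′ n) → AgreeBelow v π π′ →
                  ∀ i → rank π i v ≡ rank π′ i v
agreeBelow-rank {v = v} π π′ agree i = begin
  rank π i v                   ≡⟨ rank-count π i v ⟩
  count (northwestOf? π i v)   ≡⟨ count-cong (northwestOf? π i v) (northwestOf? π′ i v)
                                    (λ _ → mk⇔ (map₂ (agreeBelow-below π π′ agree))
                                               (map₂ (agreeBelow-below π′ π agree′))) ⟩
  count (northwestOf? π′ i v)  ≡⟨ rank-count π′ i v ⟨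
  rank π′ i v                  ∎
  where
  open ≡-Reasoning
  agree′ = agreeBelow-sym π π′ agree

agreeBelow-moved : ∀ {n v} (π π′ : Permutation′ n) → AgreeBelow v π π′ →
                   π ⟨$⟩ˡ v ≢ π′ ⟨$⟩ˡ v → v < π′ ⟨$⟩ʳ (π ⟨$⟩ˡ v)
agreeBelow-moved {v = v} π π′ agree P≢P′ with <-cmp (π′ ⟨$⟩ʳ (π ⟨$⟩ˡ v)) v
... | tri< π′P<v _ _ = contradiction (agreeBelow-below π′ π (agreeBelow-sym π π′ agree) π′P<v)
                                     (<-irrefl (inverseʳ π))
... | tri≈ _ π′P≡v _ = contradiction (trans (sym (inverseˡ π′)) (cong (π′ ⟨$⟩ˡ_) π′P≡v)) P≢P′
... | tri> _ _ v<π′P = v<π′P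

SameLowRankSquares SameBPairs : ℕ → ∀ {n} → Permutation′ n → Permutation′ n → Set
SameLowRankSquares m π π′ = ∀ i j → LowRankSquare m π i j ⇔ LowRankSquare m π′ i j
SameBPairs         m π π′ = ∀ i j → BPair m π i j ⇔ BPair m π′ i j

agreeBelow⇒inverse≮ : ∀ k {n} (π π′ : Permutation′ n) →
  SameLowRankSquares (2 + k) π π′ → SameBPairs (2 + k) π π′ →
  ∀ {v} → AgreeBelow v π π′ → ¬ (π ⟨$⟩ˡ v < π′ ⟨$⟩ˡ v)
agreeBelow⇒inverse≮ k π π′ squares pairs {v} agree P<P′ = by-rank (k ℕ.≤? rank π P v)
  where
  P  = π ⟨$⟩ˡ v
  P′ = π′ ⟨$⟩ˡ v

  v<π′P : v < π′ ⟨$⟩ʳ P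
  v<π′P = agreeBelow-moved π π′ agree (<⇒≢ P<P′)

  v<πP′ : v < π ⟨$⟩ʳ P′
  v<πP′ = agreeBelow-moved π′ π (agreeBelow-sym π π′ agree) (<⇒≢ P<P′ ∘ sym)

  by-rank : Dec (k ℕ.≤ rank π P v) → ⊥
  by-rank (yes k≤rank) =
    <-asym v<π′P (subst (π′ ⟨$⟩ʳ P <_) (inverseʳ π′) (BPair⇒< π′ BPair′))
    where
    BPair′ : BPair (2 + k) π′ P P′
    BPair′ = Equivalence.to (pairs P P′) (BPair-intro π P<P′
      (subst (_< π ⟨$⟩ʳ P′) (sym (inverseʳ π)) v<πP′)
      (subst (λ w → k ℕ.≤ rank π P w) (sym (inverseʳ π)) k≤rank))
  by-rank (no k≰rank) =
    dot-not-DiagramSquare π v (proj₁ (Equivalence.from (squares P v) (square′ , low-rank′)))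
    where
    square′ : DiagramSquare π′ P v
    square′ = v<π′P , P<P′

    low-rank′ : rank π′ P v + 3 ℕ.≤ 2 + k
    low-rank′ = subst (ℕ._≤ 2 + k)
      (trans (ℕ.+-comm 3 _) (cong (_+ 3) (agreeBelow-rank π π′ agree P)))
      (s≤s (s≤s (ℕ.≰⇒> k≰rank)))

inverses-agree : ∀ k {n} (π π′ : Permutation′ n) →
  SameLowRankSquares (2 + k) π π′ → SameBPairs (2 + k) π π′ → ∀ v → π ⟨$⟩ˡ v ≡ π′ ⟨$⟩ˡ v
inverses-agree k π π′ squares pairs = WF.All.wfRec <-wellFounded 0ℓ _ step
  where
  step : ∀ v → AgreeBelow v π π′ → π ⟨$⟩ˡ v ≡ π′ ⟨$⟩ˡ v
  step v agree with <-cmp (π ⟨$⟩ˡ v) (π′ ⟨$⟩ˡ v)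
  ... | tri< P<P′ _ _ = ⊥-elim (agreeBelow⇒inverse≮ k π π′ squares pairs agree P<P′)
  ... | tri≈ _ P≡P′ _ = P≡P′
  ... | tri> _ _ P′<P = ⊥-elim (agreeBelow⇒inverse≮ k π′ π (⇔.sym ∘₂ squares) (⇔.sym ∘₂ pairs)
                                  (agreeBelow-sym π π′ agree) P′<P)

proposition2 : ∀ (m n : ℕ) → 2 ≤ m → 1 ≤ n → (π π′ : Permutation′ n) →
    (∀ (i j : Fin n) → LowRankSquare m π i j ⇔ LowRankSquare m π′ i j) →
    (∀ (i j : Fin n) → BPair m π i j ⇔ BPair m π′ i j) →
    ∀ (i : Fin n) → π ⟨$⟩ʳ i ≡ π′ ⟨$⟩ʳ i
proposition2 (suc (suc k)) n (s≤s (s≤s z≤n)) _ π π′ squares pairs i = begin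
  π ⟨$⟩ʳ i                        ≡⟨ inverseʳ π′ ⟨
  π′ ⟨$⟩ʳ (π′ ⟨$⟩ˡ (π ⟨$⟩ʳ i))   ≡⟨ cong (π′ ⟨$⟩ʳ_) (inverses-agree k π π′ squares pairs _) ⟨
  π′ ⟨$⟩ʳ (π ⟨$⟩ˡ (π ⟨$⟩ʳ i))    ≡⟨ cong (π′ ⟨$⟩ʳ_) (inverseˡ π) ⟩
  π′ ⟨$⟩ʳ i                       ∎
  where open ≡-Reasoning
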